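{- Let $G$ be an almost-spider graph. Then $G$ is $2$-admissible if and only if $G$ is an $\mathcal{S}$-almost-thin-spider (false or true) or $G$ is a $\mathcal{K}$-true-almost-thin-spider.
   Context: All graphs are finite and simple. A spider is a graph whose vertex set is partitioned into sets $\mathcal{S},\mathcal{K},\mathcal{R}$ such that: $\mathcal{K}$ is a clique, $\mathcal{S}$ is an independent set and $|\mathcal{S}|=|\mathcal{K}|\ge 2$; every vertex of $\mathcal{R}$ is adjacent to all vertices of $\mathcal{K}$ and to no vertex of $\mathcal{S}$; and there is a bijection $f:\mathcal{S}\to\mathcal{K}$ such that either $N(x)=\{f(x)\}$ for all $x\in\mathcal{S}$ (a thin spider) or $N(x)=\mathcal{K}\setminus\{f(x)\}$ for all $x\in\mathcal{S}$ (a thick spider). An almost-spider $H$ is obtained from a spider $G$ by adding a new vertex $v'$ that is a false twin (same open neighbourhood, nonadjacent) or a true twin (same closed neighbourhood, adjacent) of some vertex $v\in\mathcal{P}$, where $\mathcal{P}\in\{\mathcal{S},\mathcal{K}\}$; $H$ is then called a $\mathcal{P}$-false-almost-spider or $\mathcal{P}$-true-almost-spider respectively, and, if $G$ is thin (resp. thick), a $\mathcal{P}$-false/true-almost-thin-spider (resp. almost-thick-spider). A tree $t$-spanner of $G$ is a spanning tree $T$ with $d_T(u,v)\le t$ for every edge $uv$ of $G$; $G$ is $t$-admissible if it has a tree $t$-spanner. -}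

module Defs where

open import Data.Nat using (ℕ; zero; suc; _+_; _≤_)
open import Data.Fin using (Fin; zero; suc; inject₁; fromℕ; punchIn)
open import Data.Bool using (Bool; true; false)
open import Data.Product using (Σ; ∃; ∃₂; _×_; _,_)
open import Data.Sum using (_⊎_)
open import Relation.Binary.PropositionalEquality using (_≡_; _≢_)
open import Relation.Nullary using (¬_)
open import Function.Bundles using (_⇔_)
open import Function.Definitions using (Injective)

record Graph (n : ℕ) : Set where
  field
    adj    : Fin n → Fin n → Bool
    sym    : ∀ u v → adj u v ≡ adj v u
    irrefl : ∀ u → adj u u ≡ false

  Adj : Fin n → Fin n → Set
  Adj u v = adj u v ≡ true

open Graph public

delete : ∀ {n} → Graph (suc n) → Fin (suc n) → Graph n
delete H v' = record
  { adj    = λ i j → adj H (punchIn v' i) (punchIn v' j)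
  ; sym    = λ i j → sym H (punchIn v' i) (punchIn v' j)
  ; irrefl = λ i → irrefl H (punchIn v' i)
  }

data Walk {n} (G : Graph n) : Fin n → Fin n → ℕ → Set where
  nil  : ∀ {u} → Walk G u u 0
  cons : ∀ {u w v k} → Adj G u w → Walk G w v k → Walk G u v (suc k)

DistLe : ∀ {n} → Graph n → Fin n → Fin n → ℕ → Set
DistLe G u v t = Σ ℕ λ k → k ≤ t × Walk G u v k

Connected : ∀ {n} → Graph n → Set
Connected G = ∀ u v → Σ ℕ λ k → Walk G u v k

Cycle : ∀ {n} → Graph n → Set
Cycle {n} G =
  Σ ℕ λ m → Σ (Fin (3 + m) → Fin n) λ c →
    Injective _≡_ _≡_ c
    × (∀ (i : Fin (2 + m)) → Adj G (c (inject₁ i)) (c (suc i)))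
    × Adj G (c (fromℕ (2 + m))) (c zero)

Acyclic : ∀ {n} → Graph n → Set
Acyclic G = ¬ Cycle G

IsTree : ∀ {n} → Graph n → Set
IsTree G = Connected G × Acyclic G

Subgraph : ∀ {n} → Graph n → Graph n → Set
Subgraph T G = ∀ u v → Adj T u v → Adj G u v

IsTreeSpanner : ∀ {n} → ℕ → Graph n → Graph n → Set
IsTreeSpanner t G T =
  Subgraph T G × IsTree T × (∀ u v → Adj G u v → DistLe T u v t)

Admissible : ∀ {n} → ℕ → Graph n → Set
Admissible t G = Σ (Graph _) λ T → IsTreeSpanner t G T

data Part : Set where
  S K R : Part

record Spider {n} (G : Graph n) : Set where
  field
    part     : Fin n → Part
    f        : Fin n → Fin n
    K-clique : ∀ u v → part u ≡ K → part v ≡ K → u ≢ v → Adj G u v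
    S-indep  : ∀ u v → part u ≡ S → part v ≡ S → ¬ Adj G u v
    f-into   : ∀ x → part x ≡ S → part (f x) ≡ K
    f-inj    : ∀ x y → part x ≡ S → part y ≡ S → f x ≡ f y → x ≡ y
    f-surj   : ∀ k → part k ≡ K → Σ (Fin n) λ x → part x ≡ S × f x ≡ k
    S≥2      : Σ (Fin n) λ x → Σ (Fin n) λ y → part x ≡ S × part y ≡ S × x ≢ y
    R-K      : ∀ r k → part r ≡ R → part k ≡ K → Adj G r k
    R-S      : ∀ r s → part r ≡ R → part s ≡ S → ¬ Adj G r s

open Spider public

data Thickness : Set where
  thin thick : Thickness

SpiderKind : ∀ {n} {G : Graph n} → Thickness → Spider G → Set
SpiderKind {n} {G} thin  sp =
  ∀ x → part sp x ≡ S → ∀ y → Adj G x y ⇔ (y ≡ f sp x)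
SpiderKind {n} {G} thick sp =
  ∀ x → part sp x ≡ S → ∀ y → Adj G x y ⇔ (part sp y ≡ K × y ≢ f sp x)

data TwinType : Set where
  false-twin true-twin : TwinType

TwinOf : ∀ {n} → Graph n → TwinType → Fin n → Fin n → Set
TwinOf H false-twin v' v = v' ≢ v × (∀ w → Adj H v' w ⇔ Adj H v w)
TwinOf H true-twin  v' v =
  v' ≢ v × (∀ w → (w ≡ v' ⊎ Adj H v' w) ⇔ (w ≡ v ⊎ Adj H v w))

-- H is a P-(false/true)-almost-(thin/thick)-spider: deleting some vertex v'
-- leaves a (thin/thick) spider G in which v' was a (false/true) twin of
-- some vertex v ∈ P.
record AlmostSpider {n} (H : Graph (suc n)) (th : Thickness) (P : Part)
                    (tw : TwinType) : Set where
  field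
    v'   : Fin (suc n)
    sp   : Spider (delete H v')
    kind : SpiderKind th sp
    v    : Fin n
    v∈P  : part sp v ≡ P
    twin : TwinOf H tw v' (punchIn v' v)

IsAlmostSpider : ∀ {n} → Graph (suc n) → Set
IsAlmostSpider H =
  Σ Thickness λ th → Σ TwinType λ tw →
    AlmostSpider H th S tw ⊎ AlmostSpider H th K tw

module Submission where

-- Sufficiency: for a thin spider whose added vertex v' is a twin of some x ∈ S, or a true
-- twin of some x ∈ K, hang each s ∈ S from f s and every other vertex, v' included, from
-- the body vertex k₀ = f x (resp. k₀ = x). Every edge then joins a vertex to its parent or
-- two children of k₀, so this tree is a 2-spanner.
--
-- Necessity: excluding cycles of length at most six in a tree 2-spanner T of H shows that
-- (a) every clique of H on at least three vertices is a star in T, and (b) no vertex of H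
-- has as its only neighbours a vertex a with a further neighbour and a nonadjacent twin a'
-- of a. For a thick spider with |K| ≥ 3 the centre of the star on K leaves some leg with two
-- neighbours that T reaches only through that centre; a thick spider with |K| = 2 is also
-- thin; and a K-false-almost-thin-spider contains configuration (b) at the leg s with f s = x.

open import Defs hiding (sym)
open import Data.Nat using (ℕ; zero; suc; _+_; _≤_; _<_; z≤n; s≤s)
open import Data.Nat.Properties
  using (≤-refl; ≤-trans; ≤-total; <-irrefl; <-≤-trans; ≤-pred; n≮0; module ≤-Reasoning)
open import Data.Fin using (Fin; zero; suc; inject₁; fromℕ; punchIn; punchOut)
open import Data.Fin.Properties
  using (_≟_; suc-injective; punchIn-injective; punchInᵢ≢i; punchIn-punchOut; punchOut-punchIn;
         punchOut-cong; any?)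
import Data.Fin.Relation.Unary.Top as Top
open import Data.Vec using (Vec; []; _∷_; lookup)
open import Data.Vec.Relation.Unary.All using ([]; _∷_)
open import Data.Vec.Relation.Unary.AllPairs using ([]; _∷_)
open import Data.Vec.Relation.Unary.Linked using (Linked; [-]; _∷_)
open import Data.Vec.Relation.Unary.Unique.Propositional using (Unique)
open import Data.Vec.Relation.Unary.Unique.Propositional.Properties using (lookup-injective)
open import Data.Product using (Σ; _×_; _,_; proj₁; proj₂)
open import Data.Sum using (_⊎_; inj₁; inj₂; [_,_]; swap; map)
open import Data.Bool using (true)
open import Data.Empty using (⊥; ⊥-elim)
open import Relation.Binary.PropositionalEquality using (_≡_; _≢_; refl; sym; trans; cong; subst; ≢-sym)
open import Relation.Nullary using (¬_; Dec; yes; no; does)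
open import Relation.Nullary.Decidable using (dec-true; dec-false; does-⇔; ¬?; _×-dec_; _⊎-dec_)
open import Function.Bundles using (_⇔_; mk⇔; Equivalence)

-- Graphs, walks and short cycles

adj-sym : ∀ {N} (G : Graph N) {u v} → Adj G u v → Adj G v u
adj-sym G {u} {v} uv = trans (Graph.sym G v u) uv

adj⇒≢ : ∀ {N} (G : Graph N) {u v} → Adj G u v → u ≢ v
adj⇒≢ G {u} uv refl with trans (sym uv) (irrefl G u)
... | ()

walk-++ : ∀ {N} {G : Graph N} {u w v k l} → Walk G u w k → Walk G w v l → Walk G u v (k + l)
walk-++ nil q = q
walk-++ (cons a p) q = cons a (walk-++ p q)

walk-snoc : ∀ {N} {G : Graph N} {u w v k} → Walk G u w k → Adj G w v → Walk G u v (suc k)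
walk-snoc nil a = cons a nil
walk-snoc (cons b p) a = cons b (walk-snoc p a)

walk-reverse : ∀ {N} {G : Graph N} {u v k} → Walk G u v k → Walk G v u k
walk-reverse nil = nil
walk-reverse {G = G} (cons a p) = walk-snoc (walk-reverse p) (adj-sym G a)

linked-lookup : ∀ {A : Set} {R : A → A → Set} {m} {xs : Vec A (suc m)} →
                Linked R xs → ∀ (i : Fin m) → R (lookup xs (inject₁ i)) (lookup xs (suc i))
linked-lookup {xs = _ ∷ _ ∷ _} (r ∷ _) zero = r
linked-lookup (_ ∷ rs) (suc i) = linked-lookup rs i

closed-path⇒cycle : ∀ {N} (G : Graph N) m (cs : Vec (Fin N) (3 + m)) → Unique cs →
                    Linked (Adj G) cs → Adj G (lookup cs (fromℕ (2 + m))) (lookup cs zero) → Cycle G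
closed-path⇒cycle G m cs distinct path closing =
  m , lookup cs , lookup-injective distinct _ _ , linked-lookup path , closing

module NoShortCycles {N} (T : Graph N) (acyclic : Acyclic T) where

  private
    ≢← : ∀ {u v} → Adj T u v → v ≢ u
    ≢← uv = ≢-sym (adj⇒≢ T uv)

  no-3-cycle : ∀ {a b c} → Adj T a b → Adj T b c → Adj T c a → ⊥
  no-3-cycle {a} {b} {c} ab bc ca =
    acyclic (closed-path⇒cycle T 0 (a ∷ b ∷ c ∷ [])
      ((adj⇒≢ T ab ∷ ≢← ca ∷ []) ∷ (adj⇒≢ T bc ∷ []) ∷ [] ∷ [])
      (ab ∷ bc ∷ [-]) ca)

  no-4-cycle : ∀ {a b c d} → a ≢ c → b ≢ d →
               Adj T a b → Adj T b c → Adj T c d → Adj T d a → ⊥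
  no-4-cycle {a} {b} {c} {d} a≢c b≢d ab bc cd da =
    acyclic (closed-path⇒cycle T 1 (a ∷ b ∷ c ∷ d ∷ [])
      ((adj⇒≢ T ab ∷ a≢c ∷ ≢← da ∷ []) ∷ (adj⇒≢ T bc ∷ b≢d ∷ []) ∷ (adj⇒≢ T cd ∷ []) ∷ [] ∷ [])
      (ab ∷ bc ∷ cd ∷ [-]) da)

  no-5-cycle : ∀ {a b c d e} → a ≢ c → a ≢ d → b ≢ d → b ≢ e → c ≢ e →
               Adj T a b → Adj T b c → Adj T c d → Adj T d e → Adj T e a → ⊥
  no-5-cycle {a} {b} {c} {d} {e} a≢c a≢d b≢d b≢e c≢e ab bc cd de ea =
    acyclic (closed-path⇒cycle T 2 (a ∷ b ∷ c ∷ d ∷ e ∷ [])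
      ((adj⇒≢ T ab ∷ a≢c ∷ a≢d ∷ ≢← ea ∷ []) ∷ (adj⇒≢ T bc ∷ b≢d ∷ b≢e ∷ []) ∷
       (adj⇒≢ T cd ∷ c≢e ∷ []) ∷ (adj⇒≢ T de ∷ []) ∷ [] ∷ [])
      (ab ∷ bc ∷ cd ∷ de ∷ [-]) ea)

  no-6-cycle : ∀ {a b c d e f} → a ≢ c → a ≢ d → a ≢ e → b ≢ d → b ≢ e → b ≢ f →
               c ≢ e → c ≢ f → d ≢ f →
               Adj T a b → Adj T b c → Adj T c d → Adj T d e → Adj T e f → Adj T f a → ⊥
  no-6-cycle {a} {b} {c} {d} {e} {f} a≢c a≢d a≢e b≢d b≢e b≢f c≢e c≢f d≢f ab bc cd de ef fa =
    acyclic (closed-path⇒cycle T 3 (a ∷ b ∷ c ∷ d ∷ e ∷ f ∷ [])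
      ((adj⇒≢ T ab ∷ a≢c ∷ a≢d ∷ a≢e ∷ ≢← fa ∷ []) ∷ (adj⇒≢ T bc ∷ b≢d ∷ b≢e ∷ b≢f ∷ []) ∷
       (adj⇒≢ T cd ∷ c≢e ∷ c≢f ∷ []) ∷ (adj⇒≢ T de ∷ d≢f ∷ []) ∷ (adj⇒≢ T ef ∷ []) ∷ [] ∷ [])
      (ab ∷ bc ∷ cd ∷ de ∷ ef ∷ [-]) fa)

one-avoiding : ∀ {n} {Q : Fin n → Set} → (Σ (Fin n) λ a → Σ (Fin n) λ b → Q a × Q b × a ≢ b) →
               ∀ x → Σ (Fin n) λ y → Q y × y ≢ x
one-avoiding (a , b , qa , qb , a≢b) x with a ≟ x
... | yes refl = b , qb , ≢-sym a≢b
... | no a≢x = a , qa , a≢x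

two-avoiding : ∀ {n} {Q : Fin n → Set} {a b c} → Q a → Q b → Q c → a ≢ b → a ≢ c → b ≢ c →
               ∀ x → Σ (Fin n) λ y → Σ (Fin n) λ y' → Q y × Q y' × y ≢ y' × y ≢ x × y' ≢ x
two-avoiding {a = a} {b} {c} qa qb qc a≢b a≢c b≢c x with a ≟ x | b ≟ x
... | yes refl | _ = b , c , qb , qc , b≢c , ≢-sym a≢b , ≢-sym a≢c
... | no a≢x | yes refl = a , c , qa , qc , a≢c , a≢x , ≢-sym b≢c
... | no a≢x | no b≢x = a , b , qa , qb , a≢b , a≢x , b≢x

-- Trees given by a parent function

argmax : ∀ {k} (g : Fin (suc k) → ℕ) → Σ (Fin (suc k)) λ i → ∀ j → g j ≤ g i
argmax {zero} g = zero , λ { zero → ≤-refl }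
argmax {suc k} g with argmax (λ i → g (suc i))
... | i , max with ≤-total (g zero) (g (suc i))
...   | inj₁ le = suc i , λ { zero → le ; (suc j) → max j }
...   | inj₂ ge = zero , λ { zero → ≤-refl ; (suc j) → ≤-trans (max j) ge }

inject₁²≢2+ : ∀ {n} (i : Fin n) → inject₁ (inject₁ i) ≢ suc (suc i)
inject₁²≢2+ zero ()
inject₁²≢2+ (suc i) e = inject₁²≢2+ i (suc-injective e)

cycle-neighbours : ∀ {N} (G : Graph N) m (c : Fin (3 + m) → Fin N) →
                   (∀ (i : Fin (2 + m)) → Adj G (c (inject₁ i)) (c (suc i))) →
                   Adj G (c (fromℕ (2 + m))) (c zero) →
                   ∀ k → Σ (Fin (3 + m)) λ j → Σ (Fin (3 + m)) λ j' →
                         j ≢ j' × Adj G (c k) (c j) × Adj G (c k) (c j')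
cycle-neighbours G m c edge closing zero =
  suc zero , fromℕ (2 + m) , (λ ()) , edge zero , adj-sym G closing
cycle-neighbours G m c edge closing (suc j) with Top.view j
... | Top.‵fromℕ =
  inject₁ (fromℕ (suc m)) , zero , (λ ()) , adj-sym G (edge (fromℕ (suc m))) , closing
... | Top.‵inject₁ j' =
  inject₁ (inject₁ j') , suc (suc j') , inject₁²≢2+ j' , adj-sym G (edge (inject₁ j')) , edge (suc j')

module ParentTree {N} (root : Fin N) (parent : Fin N → Fin N) (rank : Fin N → ℕ)
                  (rank-parent< : ∀ x → x ≢ root → rank (parent x) < rank x) where

  ChildOf : Fin N → Fin N → Set
  ChildOf x y = x ≢ root × y ≡ parent x

  TreeEdge : Fin N → Fin N → Set
  TreeEdge x y = ChildOf x y ⊎ ChildOf y x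

  treeEdge? : ∀ x y → Dec (TreeEdge x y)
  treeEdge? x y = (¬? (x ≟ root) ×-dec (y ≟ parent x)) ⊎-dec (¬? (y ≟ root) ×-dec (x ≟ parent y))

  ¬childOf-self : ∀ x → ¬ ChildOf x x
  ¬childOf-self x (x≢root , x≡px) = <-irrefl (cong rank (sym x≡px)) (rank-parent< x x≢root)

  tree : Graph N
  tree = record
    { adj    = λ x y → does (treeEdge? x y)
    ; sym    = λ x y → does-⇔ (mk⇔ swap swap) (treeEdge? x y) (treeEdge? y x)
    ; irrefl = λ x → dec-false (treeEdge? x x) [ ¬childOf-self x , ¬childOf-self x ]
    }

  adj⇒treeEdge : ∀ {x y} → Adj tree x y → TreeEdge x y
  adj⇒treeEdge {x} {y} = witness (treeEdge? x y)
    where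
    witness : (d : Dec (TreeEdge x y)) → does d ≡ true → TreeEdge x y
    witness (yes e) _ = e
    witness (no _) ()

  child-adj-parent : ∀ {x} → x ≢ root → Adj tree x (parent x)
  child-adj-parent {x} x≢root = dec-true (treeEdge? x (parent x)) (inj₁ (x≢root , refl))

  parent-adj-child : ∀ {x} → x ≢ root → Adj tree (parent x) x
  parent-adj-child {x} x≢root = dec-true (treeEdge? (parent x) x) (inj₂ (x≢root , refl))

  walk-to-root : ∀ k x → rank x ≤ k → Σ ℕ (Walk tree x root)
  walk-to-root k x rank≤k with x ≟ root
  ... | yes refl = 0 , nil
  walk-to-root zero x rank≤k | no x≢root =
    ⊥-elim (n≮0 (<-≤-trans (rank-parent< x x≢root) rank≤k))
  walk-to-root (suc k) x rank≤k | no x≢root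
    with walk-to-root k (parent x) (≤-pred (<-≤-trans (rank-parent< x x≢root) rank≤k))
  ... | l , w = suc l , cons (child-adj-parent x≢root) w

  connected : Connected tree
  connected u v with walk-to-root (rank u) u ≤-refl | walk-to-root (rank v) v ≤-refl
  ... | k , wu | l , wv = k + l , walk-++ wu (walk-reverse wv)

  -- The two cycle-neighbours of a vertex of maximal rank would both be its parent.
  acyclic : Acyclic tree
  acyclic (m , c , c-injective , edge , closing) with argmax (λ i → rank (c i))
  ... | k , maximal with cycle-neighbours tree m c edge closing k
  ...   | j , j' , j≢j' , kj , kj' =
    j≢j' (c-injective (trans (is-parent j kj) (sym (is-parent j' kj'))))
    where
    is-parent : ∀ j → Adj tree (c k) (c j) → c j ≡ parent (c k)
    is-parent j kj with adj⇒treeEdge {c k} {c j} kj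
    ... | inj₁ (_ , e) = e
    ... | inj₂ (cj≢root , e) =
      ⊥-elim (<-irrefl (cong rank (sym e)) (<-≤-trans (rank-parent< (c j) cj≢root) (maximal j)))

  Siblings : Fin N → Fin N → Set
  Siblings x y = x ≢ root × y ≢ root × parent x ≡ parent y

  Kin : Fin N → Fin N → Set
  Kin x y = ChildOf x y ⊎ ChildOf y x ⊎ Siblings x y

  kin-sym : ∀ {x y} → Kin x y → Kin y x
  kin-sym (inj₁ c) = inj₂ (inj₁ c)
  kin-sym (inj₂ (inj₁ c)) = inj₁ c
  kin-sym (inj₂ (inj₂ (x≢root , y≢root , e))) = inj₂ (inj₂ (y≢root , x≢root , sym e))

  kin-below-root : ∀ {x y} → x ≢ y → parent x ≡ root → parent y ≡ root → Kin x y
  kin-below-root {x} {y} x≢y px py with x ≟ root | y ≟ root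
  ... | yes refl | _ = inj₂ (inj₁ (≢-sym x≢y , sym py))
  ... | no x≢root | yes refl = inj₁ (x≢root , sym px)
  ... | no x≢root | no y≢root = inj₂ (inj₂ (x≢root , y≢root , trans px (sym py)))

  kin⇒distLe2 : ∀ {x y} → Kin x y → DistLe tree x y 2
  kin⇒distLe2 {x} (inj₁ (x≢root , refl)) = 1 , s≤s z≤n , cons (child-adj-parent {x} x≢root) nil
  kin⇒distLe2 {y = y} (inj₂ (inj₁ (y≢root , refl))) =
    1 , s≤s z≤n , cons (parent-adj-child {y} y≢root) nil
  kin⇒distLe2 {x} {y} (inj₂ (inj₂ (x≢root , y≢root , e))) =
    2 , ≤-refl , cons (child-adj-parent {x} x≢root)
                      (cons (subst (λ p → Adj tree p y) (sym e) (parent-adj-child {y} y≢root)) nil)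

  tree-2-spanner : (H : Graph N) → (∀ x → x ≢ root → Adj H x (parent x)) →
                   (∀ u v → Adj H u v → Kin u v) → IsTreeSpanner 2 H tree
  tree-2-spanner H parent-adj kin =
    subgraph , (connected , acyclic) , λ u v uv → kin⇒distLe2 (kin u v uv)
    where
    subgraph : Subgraph tree H
    subgraph u v uv with adj⇒treeEdge {u} {v} uv
    ... | inj₁ (u≢root , refl) = parent-adj u u≢root
    ... | inj₂ (v≢root , refl) = adj-sym H (parent-adj v v≢root)

-- Local structure of tree 2-spanners

data Path≤2 {N} (T : Graph N) (u v : Fin N) : Set where
  edge : Adj T u v → Path≤2 T u v
  via  : ∀ w → Adj T u w → Adj T w v → Path≤2 T u v

distLe2⇒path≤2 : ∀ {N} {T : Graph N} {u v} → u ≢ v → DistLe T u v 2 → Path≤2 T u v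
distLe2⇒path≤2 u≢v (zero , _ , nil) = ⊥-elim (u≢v refl)
distLe2⇒path≤2 _ (suc zero , _ , cons uv nil) = edge uv
distLe2⇒path≤2 _ (suc (suc zero) , _ , cons uw (cons wv nil)) = via _ uw wv
distLe2⇒path≤2 _ (suc (suc (suc _)) , s≤s (s≤s ()) , _)

Dominates : ∀ {N} → Graph N → Fin N → (Fin N → Set) → Set
Dominates T h Q = ∀ z → Q z → z ≡ h ⊎ Adj T z h

module TreeTwoSpanner {N} (H T : Graph N) (T⊆H : Subgraph T H) (T-acyclic : Acyclic T)
                      (stretch : ∀ u v → Adj H u v → DistLe T u v 2) where

  open NoShortCycles T T-acyclic

  tree⇒adj : ∀ {u v} → Adj T u v → Adj H u v
  tree⇒adj = T⊆H _ _

  path≤2 : ∀ {u v} → Adj H u v → Path≤2 T u v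
  path≤2 uv = distLe2⇒path≤2 (adj⇒≢ H uv) (stretch _ _ uv)

  adjacent-to-an-end : ∀ {a b z} → Adj T a b → z ≢ a → z ≢ b →
                       Path≤2 T z a → Path≤2 T z b → Adj T z a ⊎ Adj T z b
  adjacent-to-an-end _ _ _ (edge za) _ = inj₁ za
  adjacent-to-an-end _ _ _ (via _ _ _) (edge zb) = inj₂ zb
  adjacent-to-an-end {a} {b} ab z≢a z≢b (via w zw wa) (via w' zw' w'b)
    with w ≟ b | w' ≟ a | w ≟ w'
  ... | yes refl | _ | _ = inj₂ zw
  ... | no _ | yes refl | _ = inj₁ zw'
  ... | no _ | no _ | yes refl = ⊥-elim (no-3-cycle wa ab (adj-sym T w'b))
  ... | no w≢b | no w'≢a | no w≢w' =
    ⊥-elim (no-5-cycle z≢a z≢b w≢b w≢w' (≢-sym w'≢a) zw wa ab (adj-sym T w'b) (adj-sym T zw'))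

  private
    edge-via-middle : ∀ {a m b z w} → a ≢ b → Adj T a m → Adj T m b → z ≢ m → z ≢ b →
                      Adj T z a → Adj T z w → Adj T w b → Adj T z m
    edge-via-middle {a} {m} {w = w} a≢b am mb z≢m z≢b za zw wb with w ≟ m | w ≟ a
    ... | yes refl | _ = zw
    ... | no _ | yes refl = ⊥-elim (no-3-cycle am mb (adj-sym T wb))
    ... | no w≢m | no w≢a =
      ⊥-elim (no-5-cycle z≢m z≢b a≢b (≢-sym w≢a) (≢-sym w≢m) za am mb (adj-sym T wb) (adj-sym T zw))

    via-via-middle : ∀ {a m b z w w'} → a ≢ b → Adj T a m → Adj T m b → z ≢ m → z ≢ a → z ≢ b →
                     Adj T z w → Adj T w a → Adj T z w' → Adj T w' b → Adj T z m
    via-via-middle {a} {m} {b} {w = w} {w'} a≢b am mb z≢m z≢a z≢b zw wa zw' w'b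
      with w ≟ m | w' ≟ m | w ≟ w' | w ≟ b | w' ≟ a
    ... | yes refl | _ | _ | _ | _ = zw
    ... | no _ | yes refl | _ | _ | _ = zw'
    ... | no w≢m | no _ | yes refl | _ | _ =
      ⊥-elim (no-4-cycle a≢b w≢m (adj-sym T wa) w'b (adj-sym T mb) (adj-sym T am))
    ... | no _ | no _ | no _ | yes refl | _ = ⊥-elim (no-3-cycle am mb wa)
    ... | no _ | no _ | no _ | no _ | yes refl = ⊥-elim (no-3-cycle am mb (adj-sym T w'b))
    ... | no w≢m | no w'≢m | no w≢w' | no w≢b | no w'≢a =
      ⊥-elim (no-6-cycle z≢a z≢m z≢b w≢m w≢b w≢w' a≢b (≢-sym w'≢a) (≢-sym w'≢m)
                         zw wa am mb (adj-sym T w'b) (adj-sym T zw'))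

  adjacent-to-middle : ∀ {a m b z} → a ≢ b → Adj T a m → Adj T m b → z ≢ m → z ≢ a → z ≢ b →
                       Path≤2 T z a → Path≤2 T z b → Adj T z m
  adjacent-to-middle a≢b am mb z≢m _ _ (edge za) (edge zb) =
    ⊥-elim (no-4-cycle z≢m a≢b za am mb (adj-sym T zb))
  adjacent-to-middle a≢b am mb z≢m _ z≢b (edge za) (via _ zw wb) =
    edge-via-middle a≢b am mb z≢m z≢b za zw wb
  adjacent-to-middle a≢b am mb z≢m z≢a _ (via _ zw wa) (edge zb) =
    edge-via-middle (≢-sym a≢b) (adj-sym T mb) (adj-sym T am) z≢m z≢a zb zw wa
  adjacent-to-middle a≢b am mb z≢m z≢a z≢b (via _ zw wa) (via _ zw' w'b) =
    via-via-middle a≢b am mb z≢m z≢a z≢b zw wa zw' w'b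

  module _ (Q : Fin N → Set) (Q-clique : ∀ a b → Q a → Q b → a ≢ b → Adj H a b) where

    middle-dominates : ∀ {a m b} → Q a → Q b → a ≢ b → Adj T a m → Adj T m b → Dominates T m Q
    middle-dominates {a} {m} {b} qa qb a≢b am mb z qz with z ≟ a | z ≟ b | z ≟ m
    ... | yes refl | _ | _ = inj₂ am
    ... | no _ | yes refl | _ = inj₂ (adj-sym T mb)
    ... | no _ | no _ | yes z≡m = inj₁ z≡m
    ... | no z≢a | no z≢b | no z≢m =
      inj₂ (adjacent-to-middle a≢b am mb z≢m z≢a z≢b
              (path≤2 (Q-clique z a qz qa z≢a)) (path≤2 (Q-clique z b qz qb z≢b)))

    clique-centre : ∀ {a b c} → Q a → Q b → Q c → a ≢ b → a ≢ c → b ≢ c →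
                    Σ (Fin N) λ h → Dominates T h Q
    clique-centre {a} {b} {c} qa qb qc a≢b a≢c b≢c with path≤2 (Q-clique a b qa qb a≢b)
    ... | via m am mb = m , middle-dominates qa qb a≢b am mb
    ... | edge ab with adjacent-to-an-end ab (≢-sym a≢c) (≢-sym b≢c)
                         (path≤2 (Q-clique c a qc qa (≢-sym a≢c)))
                         (path≤2 (Q-clique c b qc qb (≢-sym b≢c)))
    ...   | inj₁ ca = a , middle-dominates qb qc b≢c (adj-sym T ab) (adj-sym T ca)
    ...   | inj₂ cb = b , middle-dominates qa qc a≢c ab (adj-sym T cb)

  -- A path of length two from s to a neighbour y must pass through e: through any other
  -- neighbour w of s it would close the triangle w y h.
  at-most-one-neighbour-at-hub : ∀ {s h e b b'} → s ≢ h → e ≢ h →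
                                 (∀ w → Adj H s w → w ≢ e → Adj T w h) →
                                 Adj H s b → Adj H s b' → b ≢ e → b' ≢ e → b ≡ b'
  at-most-one-neighbour-at-hub {s} {h} {e} {b} {b'} s≢h e≢h at-hub sb sb' b≢e b'≢e with b ≟ b'
  ... | yes b≡b' = b≡b'
  ... | no b≢b' = ⊥-elim (combine (reach sb b≢e) (reach sb' b'≢e))
    where
    reach : ∀ {y} → Adj H s y → y ≢ e → Adj T s y ⊎ (Adj T s e × Adj T e y)
    reach {y} sy y≢e with path≤2 sy
    ... | edge sy-T = inj₁ sy-T
    ... | via w sw wy with w ≟ e
    ...   | yes refl = inj₂ (sw , wy)
    ...   | no w≢e = ⊥-elim (no-3-cycle wy (at-hub y sy y≢e) (adj-sym T (at-hub w (tree⇒adj sw) w≢e)))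

    bh = at-hub b sb b≢e
    b'h = at-hub b' sb' b'≢e

    combine : Adj T s b ⊎ (Adj T s e × Adj T e b) → Adj T s b' ⊎ (Adj T s e × Adj T e b') → ⊥
    combine (inj₁ sb-T) (inj₁ sb'-T) = no-4-cycle s≢h b≢b' sb-T bh (adj-sym T b'h) (adj-sym T sb'-T)
    combine (inj₁ sb-T) (inj₂ (se , eb')) =
      no-5-cycle s≢h (adj⇒≢ H sb') b≢b' b≢e (≢-sym e≢h)
                 sb-T bh (adj-sym T b'h) (adj-sym T eb') (adj-sym T se)
    combine (inj₂ (se , eb)) (inj₁ sb'-T) =
      no-5-cycle s≢h (adj⇒≢ H sb) (≢-sym b≢b') b'≢e (≢-sym e≢h)
                 sb'-T b'h (adj-sym T bh) (adj-sym T eb) (adj-sym T se)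
    combine (inj₂ (_ , eb)) (inj₂ (_ , eb')) = no-4-cycle e≢h b≢b' eb bh (adj-sym T b'h) (adj-sym T eb')

  -- Both edges at s must lie in T; a neighbour u ≠ s of a in T then has to be
  -- reached from a' within two steps, closing a cycle through s.
  degree-two-twin-obstruction : ∀ {s a a' k} → a ≢ a' → Adj H s a → Adj H s a' →
                                (∀ w → Adj H s w → w ≡ a ⊎ w ≡ a') → ¬ Adj H a a' →
                                (∀ u → Adj H a u → Adj H a' u) → Adj H a k → k ≢ s → ⊥
  degree-two-twin-obstruction {s} {a} {a'} {k} a≢a' sa sa' N[s] ¬aa' a⊆a' ak k≢s = closing-cycle
    where
    ¬common : ∀ u → Adj H a u → ¬ Adj H s u
    ¬common u au su with N[s] u su
    ... | inj₁ refl = adj⇒≢ H au refl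
    ... | inj₂ refl = ¬aa' au

    sa-T : Adj T s a
    sa-T with path≤2 sa
    ... | edge sa-T = sa-T
    ... | via w sw wa with N[s] w (tree⇒adj sw)
    ...   | inj₁ refl = ⊥-elim (adj⇒≢ T wa refl)
    ...   | inj₂ refl = ⊥-elim (¬aa' (adj-sym H (tree⇒adj wa)))

    sa'-T : Adj T s a'
    sa'-T with path≤2 sa'
    ... | edge sa'-T = sa'-T
    ... | via w sw wa' with N[s] w (tree⇒adj sw)
    ...   | inj₁ refl = ⊥-elim (¬aa' (tree⇒adj wa'))
    ...   | inj₂ refl = ⊥-elim (adj⇒≢ T wa' refl)

    other-tree-neighbour : Σ (Fin N) λ u → Adj T a u × u ≢ s
    other-tree-neighbour with path≤2 ak
    ... | edge ak-T = k , ak-T , k≢s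
    ... | via w aw wk = w , aw , λ { refl → ¬common k ak (tree⇒adj wk) }

    closing-cycle : ⊥
    closing-cycle with other-tree-neighbour
    ... | u , au , u≢s with path≤2 (adj-sym H (a⊆a' u (tree⇒adj au)))
    ...   | edge ua' = no-4-cycle (≢-sym u≢s) a≢a' sa-T au ua' (adj-sym T sa'-T)
    ...   | via z uz za' = no-5-cycle (≢-sym u≢s) s≢z a≢z a≢a' u≢a' sa-T au uz za' (adj-sym T sa'-T)
      where
      s≢z : s ≢ z
      s≢z refl = ¬common u (tree⇒adj au) (adj-sym H (tree⇒adj uz))
      a≢z : a ≢ z
      a≢z refl = ¬aa' (tree⇒adj za')
      u≢a' : u ≢ a'
      u≢a' refl = ¬aa' (tree⇒adj au)

-- Spiders with an added vertex

data Origin {n} (v' : Fin (suc n)) : Fin (suc n) → Set where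
  added : Origin v' v'
  kept  : ∀ i → Origin v' (punchIn v' i)

origin : ∀ {n} (v' x : Fin (suc n)) → Origin v' x
origin v' x with v' ≟ x
... | yes refl = added
... | no v'≢x = subst (Origin v') (punchIn-punchOut v'≢x) (kept (punchOut v'≢x))

extend : ∀ {n} {A : Set} (v' : Fin (suc n)) → A → (Fin n → A) → Fin (suc n) → A
extend v' a g x with v' ≟ x
... | yes _ = a
... | no v'≢x = g (punchOut v'≢x)

module _ {n} {A : Set} (v' : Fin (suc n)) (a : A) (g : Fin n → A) where

  extend-added : extend v' a g v' ≡ a
  extend-added with v' ≟ v'
  ... | yes _ = refl
  ... | no v'≢v' = ⊥-elim (v'≢v' refl)

  extend-kept : ∀ i → extend v' a g (punchIn v' i) ≡ g i
  extend-kept i with v' ≟ punchIn v' i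
  ... | yes v'≡i = ⊥-elim (punchInᵢ≢i v' i (sym v'≡i))
  ... | no _ = cong g (trans (punchOut-cong v' refl) (punchOut-punchIn v'))

_≟ₚ_ : (p q : Part) → Dec (p ≡ q)
S ≟ₚ S = yes refl
K ≟ₚ K = yes refl
R ≟ₚ R = yes refl
S ≟ₚ K = no λ ()
S ≟ₚ R = no λ ()
K ≟ₚ S = no λ ()
K ≟ₚ R = no λ ()
R ≟ₚ S = no λ ()
R ≟ₚ K = no λ ()

module _ {n} {G : Graph n} (sp : Spider G) where

  different-parts⇒≢ : ∀ {i j p q} → part sp i ≡ p → part sp j ≡ q → p ≢ q → i ≢ j
  different-parts⇒≢ i∈p j∈q p≢q refl = p≢q (trans (sym i∈p) j∈q)

  S≢K-vertex : ∀ {i j} → part sp i ≡ S → part sp j ≡ K → i ≢ j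
  S≢K-vertex i∈S j∈K = different-parts⇒≢ i∈S j∈K λ ()

  two-K-vertices : Σ (Fin n) λ k₁ → Σ (Fin n) λ k₂ → part sp k₁ ≡ K × part sp k₂ ≡ K × k₁ ≢ k₂
  two-K-vertices with S≥2 sp
  ... | x₁ , x₂ , x₁∈S , x₂∈S , x₁≢x₂ =
    f sp x₁ , f sp x₂ , f-into sp x₁ x₁∈S , f-into sp x₂ x₂∈S ,
    λ e → x₁≢x₂ (f-inj sp x₁ x₂ x₁∈S x₂∈S e)

module _ {n} {H : Graph (suc n)} {th P tw} (A : AlmostSpider H th P tw) where
  open AlmostSpider A

  twin-adj : ∀ {w} → Adj H v' w → w ≡ punchIn v' v ⊎ Adj H (punchIn v' v) w
  twin-adj = by-kind tw twin
    where
    by-kind : ∀ tw {w} → TwinOf H tw v' (punchIn v' v) →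
              Adj H v' w → w ≡ punchIn v' v ⊎ Adj H (punchIn v' v) w
    by-kind false-twin (_ , same) v'w = inj₂ (Equivalence.to (same _) v'w)
    by-kind true-twin (_ , same) v'w = Equivalence.to (same _) (inj₂ v'w)

  adj-twin : ∀ {w} → w ≢ v' → Adj H (punchIn v' v) w → Adj H v' w
  adj-twin = by-kind tw twin
    where
    by-kind : ∀ tw {w} → TwinOf H tw v' (punchIn v' v) → w ≢ v' → Adj H (punchIn v' v) w → Adj H v' w
    by-kind false-twin (_ , same) _ vw = Equivalence.from (same _) vw
    by-kind true-twin (_ , same) w≢v' vw with Equivalence.from (same _) (inj₂ vw)
    ... | inj₁ w≡v' = ⊥-elim (w≢v' w≡v')
    ... | inj₂ v'w = v'w

  ¬adj-twin : ∀ {y} → y ≢ v → ¬ Adj (delete H v') v y → ¬ Adj H v' (punchIn v' y)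
  ¬adj-twin y≢v ¬vy v'y with twin-adj v'y
  ... | inj₁ e = y≢v (punchIn-injective v' _ _ e)
  ... | inj₂ vy = ¬vy vy

-- Tree 2-spanners of almost-thin-spiders

module ThinSpiderTree {n} (H : Graph (suc n)) (v' : Fin (suc n)) (sp : Spider (delete H v'))
                      (thin-sp : SpiderKind thin sp) (k₀ : Fin n) (k₀∈K : part sp k₀ ≡ K) where

  root : Fin (suc n)
  root = punchIn v' k₀

  parentByPart : Part → Fin n → Fin (suc n)
  parentByPart S i = punchIn v' (f sp i)
  parentByPart K _ = root
  parentByPart R _ = root

  parent : Fin (suc n) → Fin (suc n)
  parent = extend v' root (λ i → parentByPart (part sp i) i)

  class : Fin (suc n) → Part
  class = extend v' R (part sp)

  height : Part → ℕ
  height S = 2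
  height K = 1
  height R = 1

  rank : Fin (suc n) → ℕ
  rank x with x ≟ root
  ... | yes _ = 0
  ... | no _ = height (class x)

  class-kept : ∀ i → class (punchIn v' i) ≡ part sp i
  class-kept = extend-kept v' R (part sp)

  parent-added : parent v' ≡ root
  parent-added = extend-added v' root _

  parent-kept-S : ∀ {i} → part sp i ≡ S → parent (punchIn v' i) ≡ punchIn v' (f sp i)
  parent-kept-S {i} i∈S = trans (extend-kept v' root _ i) (cong (λ p → parentByPart p i) i∈S)

  parent-kept-non-S : ∀ {i} → part sp i ≢ S → parent (punchIn v' i) ≡ root
  parent-kept-non-S {i} i∉S = trans (extend-kept v' root _ i) (by-part (part sp i) i∉S)
    where
    by-part : ∀ p → p ≢ S → parentByPart p i ≡ root
    by-part S p≢S = ⊥-elim (p≢S refl)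
    by-part K _ = refl
    by-part R _ = refl

  parent-non-S : ∀ {x} → class x ≢ S → parent x ≡ root
  parent-non-S {x} x∉S with origin v' x
  ... | added = parent-added
  ... | kept i = parent-kept-non-S (λ i∈S → x∉S (trans (class-kept i) i∈S))

  parent-root : parent root ≡ root
  parent-root = parent-kept-non-S (λ k₀∈S → S≢K-vertex sp k₀∈S k₀∈K refl)

  class-parent-S : ∀ {x} → class x ≡ S → class (parent x) ≡ K
  class-parent-S {x} x∈S with origin v' x
  ... | added with () ← trans (sym (extend-added v' R _)) x∈S
  ... | kept i = trans (cong class (parent-kept-S i∈S)) (trans (class-kept (f sp i)) (f-into sp i i∈S))
    where
    i∈S : part sp i ≡ S
    i∈S = trans (sym (class-kept i)) x∈S

  rank-root : rank root ≡ 0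
  rank-root with root ≟ root
  ... | yes _ = refl
  ... | no root≢root = ⊥-elim (root≢root refl)

  rank-nonroot : ∀ {x} → x ≢ root → rank x ≡ height (class x)
  rank-nonroot {x} x≢root with x ≟ root
  ... | yes x≡root = ⊥-elim (x≢root x≡root)
  ... | no _ = refl

  rank≤height : ∀ x → rank x ≤ height (class x)
  rank≤height x with x ≟ root
  ... | yes _ = z≤n
  ... | no _ = ≤-refl

  rank-parent< : ∀ x → x ≢ root → rank (parent x) < rank x
  rank-parent< x x≢root with class x ≟ₚ S
  ... | yes x∈S = begin-strict
    rank (parent x)           ≤⟨ rank≤height (parent x) ⟩
    height (class (parent x)) ≡⟨ cong height (class-parent-S x∈S) ⟩
    1                         <⟨ ≤-refl ⟩
    2                         ≡⟨ cong height (sym x∈S) ⟩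
    height (class x)          ≡⟨ rank-nonroot x≢root ⟨
    rank x                    ∎
    where open ≤-Reasoning
  ... | no x∉S = begin-strict
    rank (parent x)  ≡⟨ cong rank (parent-non-S x∉S) ⟩
    rank root        ≡⟨ rank-root ⟩
    0                <⟨ height>0 (class x) ⟩
    height (class x) ≡⟨ rank-nonroot x≢root ⟨
    rank x           ∎
    where
    open ≤-Reasoning
    height>0 : ∀ p → 0 < height p
    height>0 S = s≤s z≤n
    height>0 K = s≤s z≤n
    height>0 R = s≤s z≤n

  open ParentTree root parent rank rank-parent< public

  leg≢root : ∀ {i} → part sp i ≡ S → punchIn v' i ≢ root
  leg≢root {i} i∈S e = S≢K-vertex sp i∈S k₀∈K (punchIn-injective v' i k₀ e)

  leg-parent : ∀ {i j} → part sp i ≡ S → Adj H (punchIn v' i) (punchIn v' j) →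
               punchIn v' j ≡ parent (punchIn v' i)
  leg-parent {i} {j} i∈S ij =
    trans (cong (punchIn v') (Equivalence.to (thin-sp i i∈S j) ij)) (sym (parent-kept-S i∈S))

  module _ (v'-root : Adj H v' root) (v'-nbrs : ∀ w → Adj H v' w → parent w ≡ root) where

    parent-adj : ∀ x → x ≢ root → Adj H x (parent x)
    parent-adj x x≢root with origin v' x
    ... | added = subst (Adj H v') (sym parent-added) v'-root
    ... | kept i with part sp i ≟ₚ S
    ...   | yes i∈S = subst (Adj H (punchIn v' i)) (sym (parent-kept-S i∈S))
                            (Equivalence.from (thin-sp i i∈S (f sp i)) refl)
    ...   | no i∉S = subst (Adj H (punchIn v' i)) (sym (parent-kept-non-S i∉S)) (adj-k₀ (part sp i) refl)
      where
      i≢k₀ : i ≢ k₀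
      i≢k₀ i≡k₀ = x≢root (cong (punchIn v') i≡k₀)
      adj-k₀ : ∀ p → part sp i ≡ p → Adj (delete H v') i k₀
      adj-k₀ S i∈S = ⊥-elim (i∉S i∈S)
      adj-k₀ K i∈K = K-clique sp i k₀ i∈K k₀∈K i≢k₀
      adj-k₀ R i∈R = R-K sp i k₀ i∈R k₀∈K

    kin : ∀ u v → Adj H u v → Kin u v
    kin u v uv with origin v' u | origin v' v
    ... | added | added = ⊥-elim (adj⇒≢ H uv refl)
    ... | added | kept _ = kin-below-root (adj⇒≢ H uv) parent-added (v'-nbrs _ uv)
    ... | kept _ | added =
      kin-sym (kin-below-root (adj⇒≢ H (adj-sym H uv)) parent-added (v'-nbrs _ (adj-sym H uv)))
    ... | kept i | kept j with part sp i ≟ₚ S | part sp j ≟ₚ S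
    ...   | yes i∈S | _ = inj₁ (leg≢root i∈S , leg-parent i∈S uv)
    ...   | no _ | yes j∈S = inj₂ (inj₁ (leg≢root j∈S , leg-parent j∈S (adj-sym H uv)))
    ...   | no i∉S | no j∉S = kin-below-root (adj⇒≢ H uv) (parent-kept-non-S i∉S) (parent-kept-non-S j∉S)

    admissible : Admissible 2 H
    admissible = tree , tree-2-spanner H parent-adj kin

S-almost-thin-spider⇒admissible : ∀ {n} {H : Graph (suc n)} {tw} →
                                  AlmostSpider H thin S tw → Admissible 2 H
S-almost-thin-spider⇒admissible {H = H} A = admissible v'-root v'-nbrs
  where
  open AlmostSpider A
  open ThinSpiderTree H v' sp kind (f sp v) (f-into sp v v∈P)

  v'-root : Adj H v' root
  v'-root = adj-twin A (punchInᵢ≢i v' (f sp v)) (Equivalence.from (kind v v∈P (f sp v)) refl)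

  v'-nbrs : ∀ w → Adj H v' w → parent w ≡ root
  v'-nbrs w v'w with twin-adj A v'w
  ... | inj₁ refl = parent-kept-S v∈P
  ... | inj₂ vw with origin v' w
  ...   | added = ⊥-elim (adj⇒≢ H v'w refl)
  ...   | kept j = trans (cong parent (trans (leg-parent v∈P vw) (parent-kept-S v∈P))) parent-root

K-true-almost-thin-spider⇒admissible : ∀ {n} {H : Graph (suc n)} →
                                       AlmostSpider H thin K true-twin → Admissible 2 H
K-true-almost-thin-spider⇒admissible {H = H} A = admissible v'-root v'-nbrs
  where
  open AlmostSpider A
  open ThinSpiderTree H v' sp kind v v∈P

  v'-root : Adj H v' root
  v'-root with Equivalence.from (proj₂ twin root) (inj₁ refl)
  ... | inj₁ root≡v' = ⊥-elim (punchInᵢ≢i v' v root≡v')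
  ... | inj₂ v'root = v'root

  v'-nbrs : ∀ w → Adj H v' w → parent w ≡ root
  v'-nbrs w v'w with twin-adj A v'w
  ... | inj₁ refl = parent-root
  ... | inj₂ vw with origin v' w
  ...   | added = ⊥-elim (adj⇒≢ H v'w refl)
  ...   | kept j with part sp j ≟ₚ S
  ...     | yes j∈S = sym (leg-parent j∈S (adj-sym H vw))
  ...     | no j∉S = parent-kept-non-S j∉S

-- Almost-spiders without tree 2-spanners

K-false-almost-thin-spider-¬admissible : ∀ {n} {H : Graph (suc n)} →
                                         AlmostSpider H thin K false-twin → ¬ Admissible 2 H
K-false-almost-thin-spider-¬admissible {H = H} A (T , T⊆H , (_ , T-acyclic) , stretch)
  with f-surj sp v v∈P | one-avoiding (two-K-vertices sp) v
  where open AlmostSpider A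
... | y , y∈S , fy≡v | k , k∈K , k≢v =
  degree-two-twin-obstruction (punchInᵢ≢i v' v) y-v y-v' N[y] ¬v-v' v⊆v'
    (K-clique sp v k v∈P k∈K (≢-sym k≢v)) k≢y
  where
  open AlmostSpider A
  open TreeTwoSpanner H T T⊆H T-acyclic stretch

  y-v : Adj H (punchIn v' y) (punchIn v' v)
  y-v = Equivalence.from (kind y y∈S v) (sym fy≡v)

  y-v' : Adj H (punchIn v' y) v'
  y-v' = adj-sym H (adj-twin A (punchInᵢ≢i v' y) (adj-sym H y-v))

  N[y] : ∀ w → Adj H (punchIn v' y) w → w ≡ punchIn v' v ⊎ w ≡ v'
  N[y] w yw with origin v' w
  ... | added = inj₂ refl
  ... | kept j = inj₁ (cong (punchIn v') (trans (Equivalence.to (kind y y∈S j) yw) fy≡v))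

  ¬v-v' : ¬ Adj H (punchIn v' v) v'
  ¬v-v' vv' = adj⇒≢ H (Equivalence.to (proj₂ twin _) (adj-sym H vv')) refl

  v⊆v' : ∀ u → Adj H (punchIn v' v) u → Adj H v' u
  v⊆v' u = Equivalence.from (proj₂ twin u)

  k≢y : punchIn v' k ≢ punchIn v' y
  k≢y e = S≢K-vertex sp y∈S k∈K (sym (punchIn-injective v' k y e))

leg-apart-from-twin : ∀ {n} {H : Graph (suc n)} {P tw} (A : AlmostSpider H thick P tw) →
                      let open AlmostSpider A in
                      Σ (Fin n) λ y → part sp y ≡ S × ¬ Adj H v' (punchIn v' y)
leg-apart-from-twin {P = S} A with one-avoiding (S≥2 sp) v
  where open AlmostSpider A
... | y , y∈S , y≢v = y , y∈S , ¬adj-twin A y≢v (S-indep sp v y v∈P y∈S)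
  where open AlmostSpider A
leg-apart-from-twin {H = H} {P = K} A with f-surj sp v v∈P
  where open AlmostSpider A
... | y , y∈S , fy≡v =
  y , y∈S , ¬adj-twin A (S≢K-vertex sp y∈S v∈P)
              (λ vy → proj₂ (Equivalence.to (kind y y∈S v) (adj-sym (delete H v') vy)) (sym fy≡v))
  where open AlmostSpider A
leg-apart-from-twin {P = R} A with S≥2 sp
  where open AlmostSpider A
... | y , _ , y∈S , _ , _ =
  y , y∈S , ¬adj-twin A (different-parts⇒≢ sp y∈S v∈P λ ()) (R-S sp v y v∈P y∈S)
  where open AlmostSpider A

-- T makes the clique K a star with some centre h. If h ∈ K, the leg y with f y = h reaches
-- two other vertices of K only through h; otherwise the leg y₀ does.
module ThickSpiderSpanner {n} (H T : Graph (suc n)) (T⊆H : Subgraph T H) (T-acyclic : Acyclic T)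
       (stretch : ∀ u v → Adj H u v → DistLe T u v 2)
       (v' : Fin (suc n)) (sp : Spider (delete H v')) (thick-sp : SpiderKind thick sp)
       (y₀ : Fin n) (y₀∈S : part sp y₀ ≡ S) (¬v'-y₀ : ¬ Adj H v' (punchIn v' y₀))
       {k₁ k₂ k₃ : Fin n} (k₁∈K : part sp k₁ ≡ K) (k₂∈K : part sp k₂ ≡ K) (k₃∈K : part sp k₃ ≡ K)
       (k₁≢k₂ : k₁ ≢ k₂) (k₁≢k₃ : k₁ ≢ k₃) (k₂≢k₃ : k₂ ≢ k₃) where

  open TreeTwoSpanner H T T⊆H T-acyclic stretch

  LiftedK : Fin (suc n) → Set
  LiftedK z = Σ (Fin n) λ i → z ≡ punchIn v' i × part sp i ≡ K

  lift-≢ : ∀ {i j} → i ≢ j → punchIn v' i ≢ punchIn v' j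
  lift-≢ i≢j e = i≢j (punchIn-injective v' _ _ e)

  liftedK-clique : ∀ a b → LiftedK a → LiftedK b → a ≢ b → Adj H a b
  liftedK-clique _ _ (i , refl , i∈K) (j , refl , j∈K) a≢b =
    K-clique sp i j i∈K j∈K (λ e → a≢b (cong (punchIn v') e))

  leg≢K : ∀ {y i} → part sp y ≡ S → part sp i ≡ K → punchIn v' y ≢ punchIn v' i
  leg≢K y∈S i∈K = lift-≢ (S≢K-vertex sp y∈S i∈K)

  two-K-vertices-avoiding : ∀ x → Σ (Fin n) λ u → Σ (Fin n) λ u' →
                            part sp u ≡ K × part sp u' ≡ K × u ≢ u' × u ≢ x × u' ≢ x
  two-K-vertices-avoiding = two-avoiding k₁∈K k₂∈K k₃∈K k₁≢k₂ k₁≢k₃ k₂≢k₃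

  centre-in-K-impossible : ∀ {i} → part sp i ≡ K → Dominates T (punchIn v' i) LiftedK → ⊥
  centre-in-K-impossible {i} i∈K dominates with f-surj sp i i∈K | two-K-vertices-avoiding i
  ... | y , y∈S , fy≡i | u , u' , u∈K , u'∈K , u≢u' , u≢i , u'≢i =
    lift-≢ u≢u' (at-most-one-neighbour-at-hub (leg≢K y∈S i∈K) (≢-sym (punchInᵢ≢i v' i)) at-hub
                   (y-adj u∈K u≢i) (y-adj u'∈K u'≢i) (punchInᵢ≢i v' u) (punchInᵢ≢i v' u'))
    where
    y-adj : ∀ {j} → part sp j ≡ K → j ≢ i → Adj H (punchIn v' y) (punchIn v' j)
    y-adj j∈K j≢i = Equivalence.from (thick-sp y y∈S _) (j∈K , λ e → j≢i (trans e fy≡i))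

    at-hub : ∀ w → Adj H (punchIn v' y) w → w ≢ v' → Adj T w (punchIn v' i)
    at-hub w yw w≢v' with origin v' w
    ... | added = ⊥-elim (w≢v' refl)
    ... | kept j with Equivalence.to (thick-sp y y∈S j) yw
    ...   | j∈K , j≢fy with dominates (punchIn v' j) (j , refl , j∈K)
    ...     | inj₁ j≡i = ⊥-elim (j≢fy (trans (punchIn-injective v' j i j≡i) (sym fy≡i)))
    ...     | inj₂ j-h = j-h

  -- Taking e = y₀ in at-most-one-neighbour-at-hub is harmless: y₀ is not its own neighbour.
  centre-outside-K-impossible : ∀ {h} → Dominates T h LiftedK →
                                (∀ i → part sp i ≡ K → h ≢ punchIn v' i) → ⊥
  centre-outside-K-impossible {h} dominates outside with two-K-vertices-avoiding (f sp y₀)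
  ... | u , u' , u∈K , u'∈K , u≢u' , u≢fy₀ , u'≢fy₀ =
    lift-≢ u≢u' (at-most-one-neighbour-at-hub y₀≢h y₀≢h at-hub (y₀-adj u∈K u≢fy₀) (y₀-adj u'∈K u'≢fy₀)
                   (≢-sym (leg≢K y₀∈S u∈K)) (≢-sym (leg≢K y₀∈S u'∈K)))
    where
    y₀-adj : ∀ {j} → part sp j ≡ K → j ≢ f sp y₀ → Adj H (punchIn v' y₀) (punchIn v' j)
    y₀-adj j∈K j≢fy₀ = Equivalence.from (thick-sp y₀ y₀∈S _) (j∈K , j≢fy₀)

    K-at-hub : ∀ j → part sp j ≡ K → Adj T (punchIn v' j) h
    K-at-hub j j∈K with dominates (punchIn v' j) (j , refl , j∈K)
    ... | inj₁ j≡h = ⊥-elim (outside j j∈K (sym j≡h))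
    ... | inj₂ j-h = j-h

    y₀≢h : punchIn v' y₀ ≢ h
    y₀≢h refl = proj₂ (Equivalence.to (thick-sp y₀ y₀∈S _)
                         (adj-sym H (tree⇒adj (K-at-hub (f sp y₀) (f-into sp y₀ y₀∈S))))) refl

    at-hub : ∀ w → Adj H (punchIn v' y₀) w → w ≢ punchIn v' y₀ → Adj T w h
    at-hub w y₀w _ with origin v' w
    ... | added = ⊥-elim (¬v'-y₀ (adj-sym H y₀w))
    ... | kept j = K-at-hub j (proj₁ (Equivalence.to (thick-sp y₀ y₀∈S j) y₀w))

  impossible : ⊥
  impossible with clique-centre LiftedK liftedK-clique
                     (k₁ , refl , k₁∈K) (k₂ , refl , k₂∈K) (k₃ , refl , k₃∈K)
                     (lift-≢ k₁≢k₂) (lift-≢ k₁≢k₃) (lift-≢ k₂≢k₃)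
  ... | h , dominates with origin v' h
  ...   | added = centre-outside-K-impossible dominates (λ i _ e → punchInᵢ≢i v' i (sym e))
  ...   | kept j with part sp j ≟ₚ K
  ...     | yes j∈K = centre-in-K-impossible j∈K dominates
  ...     | no j∉K = centre-outside-K-impossible dominates
                       (λ i i∈K e → j∉K (trans (cong (part sp) (punchIn-injective v' j i e)) i∈K))

-- With only two vertices in K, "adjacent to all of K but f x" means "adjacent to the other one".
module TwoLeggedThickSpider {n} {G : Graph n} (sp : Spider G) (thick-sp : SpiderKind thick sp)
       {k₁ k₂ : Fin n} (k₁∈K : part sp k₁ ≡ K) (k₂∈K : part sp k₂ ≡ K) (k₁≢k₂ : k₁ ≢ k₂)
       (only-two : ∀ k → part sp k ≡ K → k ≡ k₁ ⊎ k ≡ k₂) where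

  other : Fin n → Fin n
  other k with k ≟ k₁
  ... | yes _ = k₂
  ... | no _ = k₁

  other-∈K : ∀ k → part sp (other k) ≡ K
  other-∈K k with k ≟ k₁
  ... | yes _ = k₂∈K
  ... | no _ = k₁∈K

  other-≢ : ∀ k → other k ≢ k
  other-≢ k with k ≟ k₁
  ... | yes refl = ≢-sym k₁≢k₂
  ... | no k≢k₁ = ≢-sym k≢k₁

  ≢⇒other : ∀ {k j} → part sp k ≡ K → part sp j ≡ K → j ≢ k → j ≡ other k
  ≢⇒other {k} {j} k∈K j∈K j≢k with k ≟ k₁ | only-two j j∈K
  ... | yes refl | inj₁ refl = ⊥-elim (j≢k refl)
  ... | yes refl | inj₂ j≡k₂ = j≡k₂
  ... | no _ | inj₁ j≡k₁ = j≡k₁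
  ... | no k≢k₁ | inj₂ refl with only-two k k∈K
  ...   | inj₁ k≡k₁ = ⊥-elim (k≢k₁ k≡k₁)
  ...   | inj₂ refl = ⊥-elim (j≢k refl)

  other-involutive : ∀ {k} → part sp k ≡ K → other (other k) ≡ k
  other-involutive {k} k∈K = sym (≢⇒other (other-∈K k) k∈K (≢-sym (other-≢ k)))

  thin-spider : Spider G
  thin-spider = record
    { part = part sp ; f = λ x → other (f sp x)
    ; K-clique = K-clique sp ; S-indep = S-indep sp
    ; f-into = λ x _ → other-∈K (f sp x)
    ; f-inj = λ x y x∈S y∈S e → f-inj sp x y x∈S y∈S
                (trans (sym (other-involutive (f-into sp x x∈S)))
                       (trans (cong other e) (other-involutive (f-into sp y y∈S))))
    ; f-surj = λ k k∈K → let (x , x∈S , fx≡) = f-surj sp (other k) (other-∈K k)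
                         in x , x∈S , trans (cong other fx≡) (other-involutive k∈K)
    ; S≥2 = S≥2 sp ; R-K = R-K sp ; R-S = R-S sp
    }

  is-thin : SpiderKind thin thin-spider
  is-thin x x∈S y = mk⇔
    (λ xy → let (y∈K , y≢fx) = Equivalence.to (thick-sp x x∈S y) xy
            in ≢⇒other (f-into sp x x∈S) y∈K y≢fx)
    (λ { refl → Equivalence.from (thick-sp x x∈S _) (other-∈K (f sp x) , other-≢ (f sp x)) })

admissible-almost-spider-is-thin : ∀ {n} {H : Graph (suc n)} {th P tw} → Admissible 2 H →
                                   AlmostSpider H th P tw → AlmostSpider H thin P tw
admissible-almost-spider-is-thin {th = thin} _ A = A
admissible-almost-spider-is-thin {H = H} {thick} (T , T⊆H , (_ , T-acyclic) , stretch) A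
  with two-K-vertices sp | leg-apart-from-twin A
  where open AlmostSpider A
... | k₁ , k₂ , k₁∈K , k₂∈K , k₁≢k₂ | y₀ , y₀∈S , ¬v'-y₀
  with any? (λ k → (part sp k ≟ₚ K) ×-dec (¬? (k ≟ k₁) ×-dec ¬? (k ≟ k₂)))
  where open AlmostSpider A
...   | yes (k₃ , k₃∈K , k₃≢k₁ , k₃≢k₂) =
  ⊥-elim (ThickSpiderSpanner.impossible H T T⊆H T-acyclic stretch v' sp kind y₀ y₀∈S ¬v'-y₀
            k₁∈K k₂∈K k₃∈K k₁≢k₂ (≢-sym k₃≢k₁) (≢-sym k₃≢k₂))
  where open AlmostSpider A
...   | no ¬third = record { AlmostSpider A ; sp = thin-spider ; kind = is-thin }
  where
  open AlmostSpider A
  only-two : ∀ k → part sp k ≡ K → k ≡ k₁ ⊎ k ≡ k₂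
  only-two k k∈K with k ≟ k₁ | k ≟ k₂
  ... | yes k≡k₁ | _ = inj₁ k≡k₁
  ... | no _ | yes k≡k₂ = inj₂ k≡k₂
  ... | no k≢k₁ | no k≢k₂ = ⊥-elim (¬third (k , k∈K , k≢k₁ , k≢k₂))
  open TwoLeggedThickSpider sp kind k₁∈K k₂∈K k₁≢k₂ only-two


SpannableAlmostSpider : ∀ {n} → Graph (suc n) → Set
SpannableAlmostSpider H = (Σ TwinType λ tw → AlmostSpider H thin S tw) ⊎ AlmostSpider H thin K true-twin

spannable⇒admissible : ∀ {n} {H : Graph (suc n)} → SpannableAlmostSpider H → Admissible 2 H
spannable⇒admissible (inj₁ (_ , A)) = S-almost-thin-spider⇒admissible A
spannable⇒admissible (inj₂ A) = K-true-almost-thin-spider⇒admissible A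

admissible-thin⇒spannable : ∀ {n} {H : Graph (suc n)} tw → Admissible 2 H →
                            AlmostSpider H thin S tw ⊎ AlmostSpider H thin K tw → SpannableAlmostSpider H
admissible-thin⇒spannable tw _ (inj₁ A) = inj₁ (tw , A)
admissible-thin⇒spannable true-twin _ (inj₂ A) = inj₂ A
admissible-thin⇒spannable false-twin adm (inj₂ A) = ⊥-elim (K-false-almost-thin-spider-¬admissible A adm)

lemma6 : (n : ℕ) (H : Graph (suc n)) → IsAlmostSpider H →
    Admissible 2 H ⇔
      ((Σ TwinType λ tw → AlmostSpider H thin S tw) ⊎ AlmostSpider H thin K true-twin)
lemma6 n H (th , tw , A) = mk⇔ necessary spannable⇒admissible
  where
  necessary : Admissible 2 H → SpannableAlmostSpider H
  necessary adm = admissible-thin⇒spannable tw adm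
                    (map (admissible-almost-spider-is-thin adm) (admissible-almost-spider-is-thin adm) A)
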